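{- Let $H\subset\mathcal P_{\mathrm{fin},0}(\mathbb N_0)$ be a divisor-closed submonoid. Let $S=\langle B\colon B\in H\rangle$ be the submonoid of $\mathbb N_0$ generated by $\bigcup_{B\in H}B$ and $T=\langle \mathrm{rev}(B)\colon B\in H\rangle$ the submonoid of $\mathbb N_0$ generated by $\bigcup_{B\in H}\mathrm{rev}(B)$. Then \[H=\mathcal P_{\mathrm{fin},0}(S)\cap \mathrm{rev}\big(\mathcal P_{\mathrm{fin},0}(T)\big).\] Moreover, there exists $A\in H$ with $S=\langle A\rangle$ and $T=\langle\mathrm{rev}(A)\rangle$, and for any such $A$ we have $H=[\![A]\!]$.
   Context: For an additive submonoid $S\subset\mathbb N_0$, $\mathcal P_{\mathrm{fin},0}(S)$ is the monoid of finite subsets of $S$ containing $0$ under set addition $A+B=\{a+b\colon a\in A,b\in B\}$ (identity $\{0\}$). For $A\subset\mathbb N_0$, $\langle A\rangle$ is the submonoid of $\mathbb N_0$ generated by $A$. For $B\in\mathcal P_{\mathrm{fin},0}(\mathbb N_0)$, $\mathrm{rev}(B)=\max B-B=\{\max B-b\colon b\in B\}$, and for a set $H$ of such sets, $\mathrm{rev}(H)=\{\mathrm{rev}(B)\colon B\in H\}$. In $\mathcal P_{\mathrm{fin},0}(\mathbb N_0)$, $B$ divides $D$ if $D=B+C$ for some $C\in\mathcal P_{\mathrm{fin},0}(\mathbb N_0)$; a submonoid $H$ is divisor-closed if it contains every divisor of each of its elements; and $[\![A]\!]=\{B\colon B\text{ divides }nA\text{ for some }n\in\mathbb N_0\}$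 is the smallest divisor-closed submonoid containing $A$, where $nA$ is the $n$-fold sumset $A+\dots+A$ and $0A=\{0\}$. -}

module Defs where

open import Data.Nat using (ℕ; zero; suc; _+_; _∸_; _⊔_)
open import Data.List using (List; []; _∷_; map; concatMap; foldr)
open import Data.List.Membership.Propositional using (_∈_)
open import Data.List.Relation.Unary.All using (All)
open import Data.Product using (Σ; ∃; _×_; _,_)
open import Function.Bundles using (_⇔_)
open import Level using (0ℓ)
open import Axiom.ExcludedMiddle using (ExcludedMiddle) public

-- Finite subsets of ℕ₀ are represented by lists (duplicates/order irrelevant);
-- sets are compared by extensional set equality _≈ₛ_.
FinSet : Set
FinSet = List ℕ

Has0 : FinSet → Set
Has0 A = 0 ∈ A

_≈ₛ_ : FinSet → FinSet → Set
A ≈ₛ B = ∀ x → (x ∈ A) ⇔ (x ∈ B)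

_⊕_ : FinSet → FinSet → FinSet
A ⊕ B = concatMap (λ a → map (a +_) B) A

_·_ : ℕ → FinSet → FinSet
zero  · A = 0 ∷ []
suc n · A = A ⊕ (n · A)

-- max B (for nonempty B; max [] = 0 is never used on a set containing 0)
maxₛ : FinSet → ℕ
maxₛ = foldr _⊔_ 0

rev : FinSet → FinSet
rev B = map (maxₛ B ∸_) B

data ⟨_⟩ (X : ℕ → Set) : ℕ → Set where
  gen0 : ⟨ X ⟩ 0
  gen  : ∀ {x} → X x → ⟨ X ⟩ x
  add  : ∀ {x y} → ⟨ X ⟩ x → ⟨ X ⟩ y → ⟨ X ⟩ (x + y)

_≐_ : (ℕ → Set) → (ℕ → Set) → Set
P ≐ Q = ∀ n → P n ⇔ Q n

_∣ₛ_ : FinSet → FinSet → Set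
B ∣ₛ D = Has0 B × Σ FinSet (λ C → Has0 C × (D ≈ₛ (B ⊕ C)))

-- H ⊆ 𝒫_fin,0(ℕ₀) is a (set-theoretic, i.e. ≈ₛ-invariant) submonoid that is divisor-closed
record DivClosedSubmonoid (H : FinSet → Set) : Set where
  field
    respects  : ∀ {A B} → A ≈ₛ B → H A → H B
    has0      : ∀ {A} → H A → Has0 A
    unit      : H (0 ∷ [])
    closed    : ∀ {A B} → H A → H B → H (A ⊕ B)
    divClosed : ∀ {B D} → H D → B ∣ₛ D → H B

S[_] : (FinSet → Set) → ℕ → Set
S[ H ] = ⟨ (λ x → Σ FinSet (λ B → H B × x ∈ B)) ⟩

T[_] : (FinSet → Set) → ℕ → Set
T[ H ] = ⟨ (λ x → Σ FinSet (λ B → H B × x ∈ rev B)) ⟩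

Pfin0 : (ℕ → Set) → FinSet → Set
Pfin0 X A = Has0 A × All X A

InRevPfin0 : (ℕ → Set) → FinSet → Set
InRevPfin0 X B = Σ FinSet (λ C → Pfin0 X C × (B ≈ₛ rev C))

⟦_⟧ : FinSet → FinSet → Set
⟦ A ⟧ B = Σ ℕ (λ n → B ∣ₛ (n · A))

{-# OPTIONS --safe #-}
-- Every subset P of ℕ₀ is generated, as a monoid, by one positive element d of P together
-- with the least element of P in each residue class mod d that P meets (choosing these
-- least elements is where excluded middle enters). As H is closed under sums, finitely many
-- generators of S and of T, hence all of them, lie in a single A ∈ H.
--
-- Conversely let B ⊆ ⟨A⟩ with max B − B ⊆ ⟨rev A⟩, so that for some k every b ∈ B lies in kA
-- and max B − b in rev(kA). Writing an element of nA as a sum in which every summand other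
-- than 0 and max A occurs fewer than max A times shows that, for a constant K, every x in
-- D = (K + 2k)A lies in (K + k)A or in k max A + (K + k)A. In both cases x ∈ B + C for
-- C = {c ∈ D : c + B ⊆ D}, so B divides D and, H being divisor-closed, B ∈ H.
module Submission where

open import Data.Empty using (⊥-elim)
open import Data.Fin using (Fin; zero; suc; toℕ)
open import Data.Fin.Properties using (toℕ≤pred[n]; toℕ-fromℕ; toℕ-inject₁)
open import Data.Fin.Relation.Unary.Top using (view; ‵fromℕ; ‵inject₁)
open import Data.List using ([]; _∷_; map; _++_; length; filter; cartesianProductWith)
open import Data.List.Membership.Propositional using (_∈_)
open import Data.List.Membership.Propositional.Properties
  using (∈-map⁺; ∈-map⁻; ∈-filter⁺; ∈-filter⁻; ∈-cartesianProductWith⁺; ∈-cartesianProductWith⁻)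
open import Data.List.Relation.Unary.All as All using (All; []; _∷_; all?)
open import Data.List.Relation.Unary.Any using (here; there)
open import Data.Nat
  using (ℕ; NonZero; zero; suc; _+_; _*_; _∸_; _⊔_; _≤_; _<_; _≰_; _≤?_; z≤n; s≤s; _≟_)
open import Data.List.Membership.DecPropositional _≟_ using (_∈?_)
open import Data.Nat.DivMod using (_%_; _/_; m≡m%n+[m/n]*n; m%n<n)
open import Data.Nat.Induction using (<-wellFounded)
open import Data.Nat.Properties
open import Algebra.Properties.CommutativeSemigroup +-commutativeSemigroup
  using (interchange; x∙yz≈y∙xz; x∙yz≈zx∙y; xy∙z≈xz∙y)
open import Data.Nat.Tactic.RingSolver using (solve-∀)
open import Data.Product using (Σ; ∃; ∃₂; _×_; _,_; proj₁; proj₂)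
open import Data.Sum using (_⊎_; inj₁; inj₂)
open import Function using (_∘_; id)
open import Function.Bundles using (_⇔_; mk⇔; Equivalence)
open import Induction.WellFounded using (Acc; acc)
open import Level using (0ℓ)
open import Relation.Binary.PropositionalEquality
open import Relation.Nullary using (yes; no)
open import Relation.Unary using (Decidable)

open import Defs

⊕≡cartesianProductWith : ∀ A B → A ⊕ B ≡ cartesianProductWith _+_ A B
⊕≡cartesianProductWith []      B = refl
⊕≡cartesianProductWith (a ∷ A) B = cong (map (a +_) B ++_) (⊕≡cartesianProductWith A B)

∈-⊕⁺ : ∀ {A B x y} → x ∈ A → y ∈ B → x + y ∈ A ⊕ B
∈-⊕⁺ {A} {B} x∈A y∈B =
  subst (_ ∈_) (sym (⊕≡cartesianProductWith A B)) (∈-cartesianProductWith⁺ _+_ x∈A y∈B)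

∈-⊕⁻ : ∀ A B {z} → z ∈ A ⊕ B → ∃₂ λ x y → x ∈ A × y ∈ B × z ≡ x + y
∈-⊕⁻ A B z∈A⊕B =
  ∈-cartesianProductWith⁻ _+_ A B (subst (_ ∈_) (⊕≡cartesianProductWith A B) z∈A⊕B)

0∈· : ∀ {A} n → 0 ∈ A → 0 ∈ n · A
0∈· zero    0∈A = here refl
0∈· (suc n) 0∈A = ∈-⊕⁺ 0∈A (0∈· n 0∈A)

∈-·-+ : ∀ {A x y} m n → x ∈ m · A → y ∈ n · A → x + y ∈ (m + n) · A
∈-·-+ zero    n (here refl) y∈nA = y∈nA
∈-·-+ {A} (suc m) n x∈ y∈nA with ∈-⊕⁻ A (m · A) x∈
... | u , v , u∈A , v∈mA , refl =
  subst (_∈ suc (m + n) · A) (sym (+-assoc u v _)) (∈-⊕⁺ u∈A (∈-·-+ m n v∈mA y∈nA))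

∈-·-mono : ∀ {A x m n} → 0 ∈ A → m ≤ n → x ∈ m · A → x ∈ n · A
∈-·-mono {A} {x} {m} 0∈A m≤n x∈mA with m≤n⇒∃[o]m+o≡n m≤n
... | o , refl = subst (_∈ (m + o) · A) (+-identityʳ x) (∈-·-+ m o x∈mA (0∈· o 0∈A))

∈⇒∈1· : ∀ {A x} → x ∈ A → x ∈ 1 · A
∈⇒∈1· {A} {x} x∈A = subst (_∈ 1 · A) (+-identityʳ x) (∈-⊕⁺ x∈A (here refl))

*∈· : ∀ {A u} n → u ∈ A → n * u ∈ n · A
*∈· zero    u∈A = here refl
*∈· (suc n) u∈A = ∈-⊕⁺ u∈A (*∈· n u∈A)

maxₛ-upper : ∀ {A x} → x ∈ A → x ≤ maxₛ A
maxₛ-upper {a ∷ A} (here refl) = m≤m⊔n a (maxₛ A)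
maxₛ-upper {a ∷ A} (there x∈A) = ≤-trans (maxₛ-upper x∈A) (m≤n⊔m a (maxₛ A))

maxₛ-least : ∀ {A m} → (∀ {x} → x ∈ A → x ≤ m) → maxₛ A ≤ m
maxₛ-least {[]}    bound = z≤n
maxₛ-least {a ∷ A} bound = ⊔-lub (bound (here refl)) (maxₛ-least (bound ∘ there))

maxₛ∈ : ∀ {A} → 0 ∈ A → maxₛ A ∈ A
maxₛ∈ {A} 0∈A with maxₛ∈⊎≡0 A
  where
  maxₛ∈⊎≡0 : ∀ A → maxₛ A ∈ A ⊎ maxₛ A ≡ 0
  maxₛ∈⊎≡0 []      = inj₂ refl
  maxₛ∈⊎≡0 (a ∷ A) with ⊔-sel a (maxₛ A) | maxₛ∈⊎≡0 A
  ... | inj₁ ≡a | _         = inj₁ (here ≡a)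
  ... | inj₂ ≡m | inj₁ m∈A  = inj₁ (there (subst (_∈ A) (sym ≡m) m∈A))
  ... | inj₂ ≡m | inj₂ m≡0  = inj₂ (trans ≡m m≡0)
... | inj₁ max∈A = max∈A
... | inj₂ max≡0 = subst (_∈ A) (sym max≡0) 0∈A

maxₛ-unique : ∀ {A m} → m ∈ A → (∀ {x} → x ∈ A → x ≤ m) → maxₛ A ≡ m
maxₛ-unique m∈A bound = ≤-antisym (maxₛ-least bound) (maxₛ-upper m∈A)

maxₛ-cong : ∀ {A B} → A ≈ₛ B → maxₛ A ≡ maxₛ B
maxₛ-cong A≈B = ≤-antisym (maxₛ-least (maxₛ-upper ∘ Equivalence.to (A≈B _)))
                          (maxₛ-least (maxₛ-upper ∘ Equivalence.from (A≈B _)))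

maxₛ-⊕ : ∀ A B → 0 ∈ A → 0 ∈ B → maxₛ (A ⊕ B) ≡ maxₛ A + maxₛ B
maxₛ-⊕ A B 0∈A 0∈B = maxₛ-unique (∈-⊕⁺ (maxₛ∈ 0∈A) (maxₛ∈ 0∈B)) bound
  where
  bound : ∀ {z} → z ∈ A ⊕ B → z ≤ maxₛ A + maxₛ B
  bound z∈ with ∈-⊕⁻ A B z∈
  ... | x , y , x∈A , y∈B , refl = +-mono-≤ (maxₛ-upper x∈A) (maxₛ-upper y∈B)

∈·⇒≤* : ∀ A {x} n → x ∈ n · A → x ≤ n * maxₛ A
∈·⇒≤* A zero    (here refl) = z≤n
∈·⇒≤* A (suc n) x∈ with ∈-⊕⁻ A (n · A) x∈
... | u , v , u∈A , v∈nA , refl = +-mono-≤ (maxₛ-upper u∈A) (∈·⇒≤* A n v∈nA)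

∈-rev⁺ : ∀ {B b} → b ∈ B → maxₛ B ∸ b ∈ rev B
∈-rev⁺ {B} = ∈-map⁺ (maxₛ B ∸_)

∈-rev⁻ : ∀ B {y} → y ∈ rev B → ∃ λ b → b ∈ B × y ≡ maxₛ B ∸ b
∈-rev⁻ B = ∈-map⁻ (maxₛ B ∸_)

maxₛ∸[maxₛ∸b]≡b : ∀ {B b} → b ∈ B → maxₛ B ∸ (maxₛ B ∸ b) ≡ b
maxₛ∸[maxₛ∸b]≡b b∈B = m∸[m∸n]≡n (maxₛ-upper b∈B)

0∈rev : ∀ {B} → 0 ∈ B → 0 ∈ rev B
0∈rev {B} 0∈B = subst (_∈ rev B) (n∸n≡0 (maxₛ B)) (∈-rev⁺ (maxₛ∈ 0∈B))

maxₛ-rev : ∀ {B} → 0 ∈ B → maxₛ (rev B) ≡ maxₛ B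
maxₛ-rev {B} 0∈B = maxₛ-unique (∈-rev⁺ 0∈B) bound
  where
  bound : ∀ {y} → y ∈ rev B → y ≤ maxₛ B
  bound y∈ with ∈-rev⁻ B y∈
  ... | b , _ , refl = m∸n≤m (maxₛ B) b

∈-≈rev⇒∸∈ : ∀ {B C b} → B ≈ₛ rev C → 0 ∈ C → b ∈ B → maxₛ B ∸ b ∈ C
∈-≈rev⇒∸∈ {B} {C} B≈revC 0∈C b∈B with ∈-rev⁻ C (Equivalence.to (B≈revC _) b∈B)
... | c , c∈C , refl =
  subst (λ m → m ∸ (maxₛ C ∸ c) ∈ C) (sym maxB≡maxC) (subst (_∈ C) (sym (maxₛ∸[maxₛ∸b]≡b c∈C)) c∈C)
  where
  maxB≡maxC : maxₛ B ≡ maxₛ C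
  maxB≡maxC = trans (maxₛ-cong B≈revC) (maxₛ-rev 0∈C)

rev-involutive : ∀ {B} → 0 ∈ B → B ≈ₛ rev (rev B)
rev-involutive {B} 0∈B x = mk⇔ to from
  where
  to : x ∈ B → x ∈ rev (rev B)
  to x∈B = subst (_∈ rev (rev B))
    (trans (cong (_∸ (maxₛ B ∸ x)) (maxₛ-rev 0∈B)) (maxₛ∸[maxₛ∸b]≡b x∈B))
    (∈-rev⁺ (∈-rev⁺ x∈B))
  from : x ∈ rev (rev B) → x ∈ B
  from x∈ with ∈-rev⁻ (rev B) x∈
  ... | y , y∈ , refl with ∈-rev⁻ B y∈
  ... | b , b∈B , refl = subst (_∈ B)
    (sym (trans (cong (_∸ (maxₛ B ∸ b)) (maxₛ-rev 0∈B)) (maxₛ∸[maxₛ∸b]≡b b∈B))) b∈B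

[m+n]∸[o+p]≡[m∸o]+[n∸p] : ∀ {m n o p} → o ≤ m → p ≤ n → (m + n) ∸ (o + p) ≡ (m ∸ o) + (n ∸ p)
[m+n]∸[o+p]≡[m∸o]+[n∸p] {m} {n} {o} {p} o≤m p≤n = begin
  (m + n) ∸ (o + p)  ≡⟨ ∸-+-assoc (m + n) o p ⟨
  (m + n) ∸ o ∸ p    ≡⟨ cong (_∸ p) (+-∸-comm n o≤m) ⟩
  (m ∸ o) + n ∸ p    ≡⟨ +-∸-assoc (m ∸ o) p≤n ⟩
  (m ∸ o) + (n ∸ p)  ∎
  where open ≡-Reasoning

rev-⊕⁺ : ∀ {A B x y} → 0 ∈ A → 0 ∈ B → x ∈ rev A → y ∈ rev B → x + y ∈ rev (A ⊕ B)
rev-⊕⁺ {A} {B} 0∈A 0∈B x∈ y∈ with ∈-rev⁻ A x∈ | ∈-rev⁻ B y∈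
... | a , a∈A , refl | b , b∈B , refl = subst (_∈ rev (A ⊕ B))
  (trans (cong (_∸ (a + b)) (maxₛ-⊕ A B 0∈A 0∈B))
         ([m+n]∸[o+p]≡[m∸o]+[n∸p] (maxₛ-upper a∈A) (maxₛ-upper b∈B)))
  (∈-rev⁺ (∈-⊕⁺ a∈A b∈B))

⟨⟩-map : ∀ {X Y : ℕ → Set} → (∀ {y} → X y → Y y) → ∀ {x} → ⟨ X ⟩ x → ⟨ Y ⟩ x
⟨⟩-map f gen0      = gen0
⟨⟩-map f (gen p)   = gen (f p)
⟨⟩-map f (add p q) = add (⟨⟩-map f p) (⟨⟩-map f q)

⟨⟩-* : ∀ {X : ℕ → Set} {s} → ⟨ X ⟩ s → ∀ q → ⟨ X ⟩ (q * s)
⟨⟩-* p zero    = gen0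
⟨⟩-* p (suc q) = add p (⟨⟩-* p q)

⟨∈⟩⇒∈· : ∀ {A x} → ⟨ (_∈ A) ⟩ x → ∃ λ n → x ∈ n · A
⟨∈⟩⇒∈· gen0      = 0 , here refl
⟨∈⟩⇒∈· (gen x∈A) = 1 , ∈⇒∈1· x∈A
⟨∈⟩⇒∈· (add p q) with ⟨∈⟩⇒∈· p | ⟨∈⟩⇒∈· q
... | m , x∈mA | n , y∈nA = m + n , ∈-·-+ m n x∈mA y∈nA

m%d≡n%d⇒n≡m+[n/d∸m/d]*d : ∀ {m n} d .{{_ : NonZero d}} → m ≤ n → m % d ≡ n % d →
                            n ≡ m + (n / d ∸ m / d) * d
m%d≡n%d⇒n≡m+[n/d∸m/d]*d {m} {n} d m≤n m%d≡n%d = begin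
  n                                     ≡⟨ m+[n∸m]≡n m≤n ⟨
  m + (n ∸ m)                           ≡⟨ cong (m +_) n∸m≡[n/d∸m/d]*d ⟩
  m + (n / d ∸ m / d) * d               ∎
  where
  open ≡-Reasoning
  n∸m≡[n/d∸m/d]*d : n ∸ m ≡ (n / d ∸ m / d) * d
  n∸m≡[n/d∸m/d]*d = begin
    n ∸ m                                     ≡⟨ cong₂ _∸_ (m≡m%n+[m/n]*n n d) (m≡m%n+[m/n]*n m d) ⟩
    (n % d + n / d * d) ∸ (m % d + m / d * d) ≡⟨ cong (λ r → (n % d + n / d * d) ∸ (r + m / d * d)) m%d≡n%d ⟩
    (n % d + n / d * d) ∸ (n % d + m / d * d) ≡⟨ [m+n]∸[m+o]≡n∸o (n % d) (n / d * d) (m / d * d) ⟩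
    n / d * d ∸ m / d * d                     ≡⟨ *-distribʳ-∸ d (n / d) (m / d) ⟨
    (n / d ∸ m / d) * d                       ∎

module Classical (em : ExcludedMiddle 0ℓ) where

  least-element : (P : ℕ → Set) → ∀ {n} → P n → ∃ λ m → P m × (∀ {k} → P k → m ≤ k)
  least-element P = go (<-wellFounded _)
    where
    go : ∀ {n} → Acc _<_ n → P n → ∃ λ m → P m × (∀ {k} → P k → m ≤ k)
    go {n} (acc below) pn with em {∃ λ k → k < n × P k}
    ... | yes (k , k<n , pk) = go (below k<n) pk
    ... | no  ∄k             = n , pn , λ pk → ≮⇒≥ (λ k<n → ∄k (_ , k<n , pk))

  residue-class-minima : ∀ d .{{_ : NonZero d}} (P : ℕ → Set) n →
    ∃ λ L → All P L × (∀ {x} → P x → x % d < n → ∃ λ m → m ∈ L × m ≤ x × m % d ≡ x % d)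
  residue-class-minima d P zero = [] , [] , λ _ ()
  residue-class-minima d P (suc n) with residue-class-minima d P n | em {∃ λ x → P x × x % d ≡ n}
  ... | L , P[L] , minima | no ∄x = L , P[L] , minima′
    where
    minima′ : ∀ {x} → P x → x % d < suc n → ∃ λ m → m ∈ L × m ≤ x × m % d ≡ x % d
    minima′ {x} px x%d<1+n with m<1+n⇒m<n∨m≡n x%d<1+n
    ... | inj₁ x%d<n = minima px x%d<n
    ... | inj₂ x%d≡n = ⊥-elim (∄x (x , px , x%d≡n))
  ... | L , P[L] , minima | yes (x₀ , px₀ , x₀%d≡n)
    with least-element (λ x → P x × x % d ≡ n) (px₀ , x₀%d≡n)
  ... | m , (pm , m%d≡n) , least = m ∷ L , pm ∷ P[L] , minima′
    where
    minima′ : ∀ {x} → P x → x % d < suc n → ∃ λ m′ → m′ ∈ m ∷ L × m′ ≤ x × m′ % d ≡ x % d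
    minima′ {x} px x%d<1+n with m<1+n⇒m<n∨m≡n x%d<1+n
    ... | inj₁ x%d<n = let (m′ , m′∈L , rest) = minima px x%d<n in m′ , there m′∈L , rest
    ... | inj₂ x%d≡n = m , here refl , least (px , x%d≡n) , trans m%d≡n (sym x%d≡n)

  finite-generators : (P : ℕ → Set) → ∃ λ L → All P L × (∀ {x} → P x → ⟨ (_∈ L) ⟩ x)
  finite-generators P with em {∃ λ s → P (suc s)}
  ... | no ∄s = [] , [] , generated
    where
    generated : ∀ {x} → P x → ⟨ (_∈ []) ⟩ x
    generated {zero}  _  = gen0
    generated {suc s} ps = ⊥-elim (∄s (s , ps))
  ... | yes (s , ps) with residue-class-minima (suc s) P (suc s)
  ... | L , P[L] , minima = suc s ∷ L , ps ∷ P[L] , generated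
    where
    generated : ∀ {x} → P x → ⟨ (_∈ suc s ∷ L) ⟩ x
    generated {x} px with minima px (m%n<n x (suc s))
    ... | m , m∈L , m≤x , m%d≡x%d =
      subst ⟨ (_∈ suc s ∷ L) ⟩ (sym (m%d≡n%d⇒n≡m+[n/d∸m/d]*d (suc s) m≤x m%d≡x%d))
        (add (gen (there m∈L)) (⟨⟩-* (gen (here refl)) (x / suc s ∸ m / suc s)))

module Tallies (a′ : ℕ) where

  Tally : FinSet → Set
  Tally = All (λ _ → Fin (suc a′))

  size : ∀ {A} → Tally A → ℕ
  size []       = 0
  size (c ∷ cs) = toℕ c + size cs

  weight : ∀ {A} → Tally A → ℕ
  weight              []       = 0
  weight {A = v ∷ _} (c ∷ cs) = toℕ c * v + weight cs

  empty : ∀ A → Tally A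
  empty []      = []
  empty (_ ∷ A) = zero ∷ empty A

  size-empty : ∀ A → size (empty A) ≡ 0
  size-empty []      = refl
  size-empty (_ ∷ A) = size-empty A

  weight-empty : ∀ A → weight (empty A) ≡ 0
  weight-empty []      = refl
  weight-empty (_ ∷ A) = weight-empty A

  size≤length*a′ : ∀ {A} (cs : Tally A) → size cs ≤ length A * a′
  size≤length*a′ []       = z≤n
  size≤length*a′ (c ∷ cs) = +-mono-≤ (toℕ≤pred[n] c) (size≤length*a′ cs)

  weight∈size· : ∀ {A B} → (∀ {u} → u ∈ B → u ∈ A) → (cs : Tally B) → weight cs ∈ size cs · A
  weight∈size· B⊆A []       = here refl
  weight∈size· B⊆A (c ∷ cs) =
    ∈-·-+ (toℕ c) (size cs) (*∈· (toℕ c) (B⊆A (here refl))) (weight∈size· (B⊆A ∘ there) cs)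

  data Bump (v : ℕ) {A} (cs : Tally A) : Set where
    incremented : (cs′ : Tally A) → size cs′ ≡ suc (size cs) → weight cs′ ≡ v + weight cs → Bump v cs
    overflowed  : (cs′ : Tally A) → size cs ≡ a′ + size cs′ → weight cs ≡ a′ * v + weight cs′ → Bump v cs

  bump : ∀ {A v} → v ∈ A → (cs : Tally A) → Bump v cs
  bump {v = v} (here refl) (c ∷ cs) with view c
  ... | ‵fromℕ = overflowed (zero ∷ cs)
    (cong (_+ size cs) (toℕ-fromℕ a′)) (cong (λ n → n * v + weight cs) (toℕ-fromℕ a′))
  ... | ‵inject₁ j = incremented (suc j ∷ cs)
    (cong (λ n → suc (n + size cs)) (sym (toℕ-inject₁ j)))
    (trans (+-assoc v (toℕ j * v) (weight cs))
           (cong (λ n → v + (n * v + weight cs)) (sym (toℕ-inject₁ j))))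
  bump {A = u ∷ _} {v} (there v∈A) (c ∷ cs) with bump v∈A cs
  ... | incremented cs′ size≡ weight≡ = incremented (c ∷ cs′)
    (trans (cong (toℕ c +_) size≡) (+-suc (toℕ c) (size cs)))
    (trans (cong (toℕ c * u +_) weight≡) (x∙yz≈y∙xz (toℕ c * u) v (weight cs)))
  ... | overflowed cs′ size≡ weight≡ = overflowed (c ∷ cs′)
    (trans (cong (toℕ c +_) size≡) (x∙yz≈y∙xz (toℕ c) a′ (size cs′)))
    (trans (cong (toℕ c * u +_) weight≡) (x∙yz≈y∙xz (toℕ c * u) (a′ * v) (weight cs′)))

excess-of-tops : ∀ {t s K k} → t + s ≤ K + k + k → s ≤ K → t + s ≰ K + k →
                 ∃ λ t′ → t ≡ k + t′ × t′ + s ≤ K + k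
excess-of-tops {t} {s} {K} {k} t+s≤K+2k s≤K t+s≰K+k with m≤n⇒∃[o]m+o≡n k≤t
  where
  open ≤-Reasoning
  k≤t : k ≤ t
  k≤t = <⇒≤ (+-cancelʳ-< K k t (begin-strict
    k + K  ≡⟨ +-comm k K ⟩
    K + k  <⟨ ≰⇒> t+s≰K+k ⟩
    t + s  ≤⟨ +-monoʳ-≤ t s≤K ⟩
    t + K  ∎))
... | t′ , refl = t′ , refl , +-cancelˡ-≤ k (t′ + s) (K + k) (begin
  k + (t′ + s)  ≡⟨ +-assoc k t′ s ⟨
  k + t′ + s    ≤⟨ t+s≤K+2k ⟩
  K + k + k     ≡⟨ +-comm (K + k) k ⟩
  k + (K + k)   ∎)
  where open ≤-Reasoning

-- A sum of M elements of A, with max A = suc a′, is recorded by a number of summands max A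
-- and a tally counting every entry of A fewer than max A times, all other summands being 0:
-- when an entry v reaches max A copies, these are traded for v copies of max A and
-- max A ∸ v zeros.
module NormalForm (A : FinSet) (a′ : ℕ) (maxₛA≡1+a′ : maxₛ A ≡ suc a′) where
  open Tallies a′

  record Representation (M x : ℕ) : Set where
    field
      tops    : ℕ
      tally   : Tally A
      bounded : tops + size tally ≤ M
      value   : x ≡ tops * suc a′ + weight tally

  insert : ∀ {v M y} → v ∈ A → Representation M y → Representation (suc M) (v + y)
  insert {v} {M} {y} v∈A record { tops = t ; tally = cs ; bounded = bounded ; value = refl }
    with bump v∈A cs
  ... | incremented cs′ size≡ weight≡ = record
    { tops    = t
    ; tally   = cs′
    ; bounded = subst (_≤ suc M) (sym (trans (cong (t +_) size≡) (+-suc t (size cs))))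
                      (s≤s bounded)
    ; value   = trans (x∙yz≈y∙xz v (t * suc a′) (weight cs)) (cong (t * suc a′ +_) (sym weight≡))
    }
  ... | overflowed cs′ size≡ weight≡ = record
    { tops    = t + v
    ; tally   = cs′
    ; bounded = begin
        t + v + size cs′        ≤⟨ +-monoˡ-≤ (size cs′) (+-monoʳ-≤ t v≤1+a′) ⟩
        t + suc a′ + size cs′   ≡⟨ cong (_+ size cs′) (+-suc t a′) ⟩
        suc (t + a′ + size cs′) ≡⟨ cong suc (trans (+-assoc t a′ (size cs′)) (cong (t +_) (sym size≡))) ⟩
        suc (t + size cs)       ≤⟨ s≤s bounded ⟩
        suc M                   ∎
    ; value   = trans (cong (λ w → v + (t * suc a′ + w)) weight≡) (exchange v t a′ (weight cs′))
    }
    where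
    open ≤-Reasoning
    v≤1+a′ : v ≤ suc a′
    v≤1+a′ = subst (v ≤_) maxₛA≡1+a′ (maxₛ-upper v∈A)
    exchange : ∀ v t a′ w → v + (t * suc a′ + (a′ * v + w)) ≡ (t + v) * suc a′ + w
    exchange = solve-∀

  represent : ∀ M {x} → x ∈ M · A → Representation M x
  represent zero (here refl) = record
    { tops = 0 ; tally = empty A ; bounded = ≤-reflexive (size-empty A) ; value = sym (weight-empty A) }
  represent (suc M) x∈ with ∈-⊕⁻ A (M · A) x∈
  ... | v , y , v∈A , y∈MA , refl = insert v∈A (represent M y∈MA)

  tops+weight∈ : 0 ∈ A → ∀ t (cs : Tally A) → t * suc a′ + weight cs ∈ (t + size cs) · A
  tops+weight∈ 0∈A t cs =
    ∈-·-+ t (size cs) (*∈· t (subst (_∈ A) maxₛA≡1+a′ (maxₛ∈ 0∈A))) (weight∈size· id cs)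

  split : ∀ k {x} → 0 ∈ A → x ∈ (length A * a′ + k + k) · A →
          x ∈ (length A * a′ + k) · A ⊎ ∃ λ y → y ∈ (length A * a′ + k) · A × x ≡ k * suc a′ + y
  split k 0∈A x∈ with represent (length A * a′ + k + k) x∈
  ... | record { tops = t ; tally = cs ; bounded = bounded ; value = refl }
    with t + size cs ≤? length A * a′ + k
  ... | yes t+s≤K+k = inj₁ (∈-·-mono 0∈A t+s≤K+k (tops+weight∈ 0∈A t cs))
  ... | no  t+s≰K+k with excess-of-tops bounded (size≤length*a′ cs) t+s≰K+k
  ... | t′ , refl , t′+s≤K+k = inj₂ (t′ * suc a′ + weight cs ,
    ∈-·-mono 0∈A t′+s≤K+k (tops+weight∈ 0∈A t′ cs) ,
    trans (cong (_+ weight cs) (*-distribʳ-+ (suc a′) k t′))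
          (+-assoc (k * suc a′) (t′ * suc a′) (weight cs)))

sumset-split : ∀ A → 0 ∈ A → ∃ λ K → ∀ k {x} → x ∈ (K + k + k) · A →
               x ∈ (K + k) · A ⊎ ∃ λ y → y ∈ (K + k) · A × x ≡ k * maxₛ A + y
sumset-split A 0∈A with maxₛ A in maxₛA≡
... | suc a′ = length A * a′ , λ k → NormalForm.split A a′ maxₛA≡ k 0∈A
-- max A = 0 forces A ⊆ {0}; there are no counts below max A then, so no tallies.
... | zero   = 0 , λ k {x} x∈ → inj₁ (subst (_∈ k · A) (sym (x≡0 k x∈)) (0∈· k 0∈A))
  where
  x≡0 : ∀ k {x} → x ∈ (k + k) · A → x ≡ 0
  x≡0 k {x} x∈ = n≤0⇒n≡0
    (subst (x ≤_) (trans (cong ((k + k) *_) maxₛA≡) (*-zeroʳ (k + k))) (∈·⇒≤* A (k + k) x∈))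

-- y ∈ rev (n · A), stated additively since maxₛ (n · A) = n * maxₛ A
InRev : ℕ → FinSet → ℕ → Set
InRev n A y = ∃ λ w → w ∈ n · A × w + y ≡ n * maxₛ A

∈·rev⇒InRev : ∀ A n {y} → y ∈ n · rev A → InRev n A y
∈·rev⇒InRev A zero    (here refl) = 0 , here refl , refl
∈·rev⇒InRev A (suc n) y∈ with ∈-⊕⁻ (rev A) (n · rev A) y∈
... | u′ , y′ , u′∈ , y′∈ , refl with ∈-rev⁻ A u′∈ | ∈·rev⇒InRev A n y′∈
... | u , u∈A , refl | w , w∈nA , w+y′≡ = u + w , ∈-⊕⁺ u∈A w∈nA , (begin
  u + w + ((maxₛ A ∸ u) + y′)    ≡⟨ interchange u w (maxₛ A ∸ u) y′ ⟩
  (u + (maxₛ A ∸ u)) + (w + y′)  ≡⟨ cong₂ _+_ (m+[n∸m]≡n (maxₛ-upper u∈A)) w+y′≡ ⟩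
  maxₛ A + n * maxₛ A            ∎)
  where open ≡-Reasoning

InRev-mono : ∀ {A m n y} → 0 ∈ A → m ≤ n → InRev m A y → InRev n A y
InRev-mono {A} {m} {y = y} 0∈A m≤n (w , w∈mA , w+y≡) with m≤n⇒∃[o]m+o≡n m≤n
... | o , refl = w + o * maxₛ A , ∈-·-+ m o w∈mA (*∈· o (maxₛ∈ 0∈A)) , (begin
  w + o * maxₛ A + y      ≡⟨ xy∙z≈xz∙y w (o * maxₛ A) y ⟩
  w + y + o * maxₛ A      ≡⟨ cong (_+ o * maxₛ A) w+y≡ ⟩
  m * maxₛ A + o * maxₛ A ≡⟨ *-distribʳ-+ (maxₛ A) m o ⟨
  (m + o) * maxₛ A        ∎)
  where open ≡-Reasoning

Upward : {X : Set} → (ℕ → X → Set) → Set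
Upward P = ∀ {m n x} → m ≤ n → P m x → P n x

uniform-bound : ∀ {X : Set} (P : ℕ → X → Set) → Upward P → ∀ xs →
                (∀ {x} → x ∈ xs → ∃ λ n → P n x) → ∃ λ n → ∀ {x} → x ∈ xs → P n x
uniform-bound P upward []       bound = 0 , λ ()
uniform-bound P upward (x ∷ xs) bound
  with bound (here refl) | uniform-bound P upward xs (bound ∘ there)
... | m , pm | n , pn = m ⊔ n , λ where
  (here refl) → upward (m≤m⊔n m n) pm
  (there x∈)  → upward (m≤n⊔m m n) (pn x∈)

w₀+b≡w : ∀ {w₀ w b m X} → b ≤ m → w₀ + m ≡ X → w + (m ∸ b) ≡ X → w₀ + b ≡ w
w₀+b≡w {w₀} {w} {b} {m} b≤m w₀+m≡X w+[m∸b]≡X = +-cancelʳ-≡ (m ∸ b) (w₀ + b) w (begin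
  w₀ + b + (m ∸ b)    ≡⟨ +-assoc w₀ b (m ∸ b) ⟩
  w₀ + (b + (m ∸ b))  ≡⟨ cong (w₀ +_) (m+[n∸m]≡n b≤m) ⟩
  w₀ + m              ≡⟨ trans w₀+m≡X (sym w+[m∸b]≡X) ⟩
  w + (m ∸ b)         ∎)
  where open ≡-Reasoning

common-level : ∀ {A B} → 0 ∈ A → (∀ {b} → b ∈ B → ⟨ (_∈ A) ⟩ b) →
  (∀ {b} → b ∈ B → ⟨ (_∈ rev A) ⟩ (maxₛ B ∸ b)) →
  ∃ λ k → ∀ {b} → b ∈ B → b ∈ k · A × InRev k A (maxₛ B ∸ b)
common-level {A} {B} 0∈A B⊆⟨A⟩ revB⊆⟨revA⟩ = uniform-bound AtLevel upward B eventually
  where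
  AtLevel : ℕ → ℕ → Set
  AtLevel n b = b ∈ n · A × InRev n A (maxₛ B ∸ b)

  upward : Upward AtLevel
  upward m≤n (b∈mA , inRev) = ∈-·-mono 0∈A m≤n b∈mA , InRev-mono 0∈A m≤n inRev

  eventually : ∀ {b} → b ∈ B → ∃ λ n → AtLevel n b
  eventually b∈B with ⟨∈⟩⇒∈· (B⊆⟨A⟩ b∈B) | ⟨∈⟩⇒∈· (revB⊆⟨revA⟩ b∈B)
  ... | m , b∈mA | n , ∸b∈n·revA = m ⊔ n ,
    ∈-·-mono 0∈A (m≤m⊔n m n) b∈mA , InRev-mono 0∈A (m≤n⊔m m n) (∈·rev⇒InRev A n ∸b∈n·revA)

⟦⟧⁺ : ∀ {A B} k → 0 ∈ A → 0 ∈ B →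
      (∀ {b} → b ∈ B → b ∈ k · A × InRev k A (maxₛ B ∸ b)) → ⟦ A ⟧ B
⟦⟧⁺ {A} {B} k 0∈A 0∈B level with sumset-split A 0∈A
... | K , split = K + k + k , 0∈B , C , 0∈C , λ x → mk⇔ D⊆B⊕C B⊕C⊆D
  where
  D : FinSet
  D = (K + k + k) · A

  fits? : Decidable (λ c → All (λ b → c + b ∈ D) B)
  fits? c = all? (λ b → c + b ∈? D) B

  C : FinSet
  C = filter fits? D

  ∈C⁺ : ∀ {c} → c ∈ D → (∀ {b} → b ∈ B → c + b ∈ D) → c ∈ C
  ∈C⁺ c∈D c+B⊆D = ∈-filter⁺ fits? c∈D (All.tabulate c+B⊆D)

  0∈C : 0 ∈ C
  0∈C = ∈C⁺ (0∈· (K + k + k) 0∈A) (λ b∈B → ∈-·-mono 0∈A (m≤n+m k (K + k)) (proj₁ (level b∈B)))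

  B⊕C⊆D : ∀ {x} → x ∈ B ⊕ C → x ∈ D
  B⊕C⊆D x∈ with ∈-⊕⁻ B C x∈
  ... | b , c , b∈B , c∈C , refl =
    subst (_∈ D) (+-comm c b) (All.lookup (proj₂ (∈-filter⁻ fits? {xs = D} c∈C)) b∈B)

  D⊆B⊕C : ∀ {x} → x ∈ D → x ∈ B ⊕ C
  D⊆B⊕C x∈D with split k x∈D
  ... | inj₁ x∈ = ∈-⊕⁺ 0∈B (∈C⁺ x∈D λ b∈B → ∈-·-+ (K + k) k x∈ (proj₁ (level b∈B)))
  ... | inj₂ (y , y∈ , refl) with proj₂ (level 0∈B)
  -- w₀ + max B = k max A gives x = max B + (y + w₀), and y + w₀ ∈ C because w₀ + b is
  -- the witness for max B ∸ b.
  ... | w₀ , w₀∈kA , w₀+maxB≡ = subst (_∈ B ⊕ C) maxB+c≡x (∈-⊕⁺ (maxₛ∈ 0∈B) c∈C)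
    where
    c+b∈D : ∀ {b} → b ∈ B → y + w₀ + b ∈ D
    c+b∈D b∈B with proj₂ (level b∈B)
    ... | w , w∈kA , w+[maxB∸b]≡ = subst (_∈ D)
        (trans (cong (y +_) (sym (w₀+b≡w (maxₛ-upper b∈B) w₀+maxB≡ w+[maxB∸b]≡)))
             (sym (+-assoc y w₀ _)))
      (∈-·-+ (K + k) k y∈ w∈kA)
    c∈C : y + w₀ ∈ C
    c∈C = ∈C⁺ (∈-·-+ (K + k) k y∈ w₀∈kA) c+b∈D
    maxB+c≡x : maxₛ B + (y + w₀) ≡ k * maxₛ A + y
    maxB+c≡x = trans (x∙yz≈zx∙y (maxₛ B) y w₀) (cong (_+ y) w₀+maxB≡)

Pfin0∩revPfin0⊆⟦⟧ : ∀ {X Y : ℕ → Set} {A B} → 0 ∈ A →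
  (∀ {x} → X x → ⟨ (_∈ A) ⟩ x) → (∀ {y} → Y y → ⟨ (_∈ rev A) ⟩ y) →
  Pfin0 X B × InRevPfin0 Y B → ⟦ A ⟧ B
Pfin0∩revPfin0⊆⟦⟧ 0∈A X⊆⟨A⟩ Y⊆⟨revA⟩ ((0∈B , X[B]) , C , (0∈C , Y[C]) , B≈revC) =
  let k , level = common-level 0∈A (X⊆⟨A⟩ ∘ All.lookup X[B])
                    (Y⊆⟨revA⟩ ∘ All.lookup Y[C] ∘ ∈-≈rev⇒∸∈ B≈revC 0∈C)
  in ⟦⟧⁺ k 0∈A 0∈B level

module DivisorClosed (H : FinSet → Set) (isH : DivClosedSubmonoid H) where
  open DivClosedSubmonoid isH

  ·-closed : ∀ {A} n → H A → H (n · A)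
  ·-closed zero    H[A] = unit
  ·-closed (suc n) H[A] = closed H[A] (·-closed n H[A])

  ⟦⟧⊆H : ∀ {A B} → H A → ⟦ A ⟧ B → H B
  ⟦⟧⊆H H[A] (n , B∣nA) = divClosed (·-closed n H[A]) B∣nA

  H⊆Pfin0[S]∩revPfin0[T] : ∀ {B} → H B → Pfin0 S[ H ] B × InRevPfin0 T[ H ] B
  H⊆Pfin0[S]∩revPfin0[T] {B} H[B] =
    (has0 H[B] , All.tabulate (λ b∈B → gen (B , H[B] , b∈B))) ,
    rev B , (0∈rev (has0 H[B]) , All.tabulate (λ b∈revB → gen (B , H[B] , b∈revB))) ,
    rev-involutive (has0 H[B])

  record Compatible (f : FinSet → FinSet) : Set where
    field
      0∈f : ∀ {D} → H D → 0 ∈ f D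
      f-⊕⁺ : ∀ {D E x y} → H D → H E → x ∈ f D → y ∈ f E → x + y ∈ f (D ⊕ E)

  module Generated {f : FinSet → FinSet} (compatible : Compatible f) where
    open Compatible compatible

    Generators : ℕ → Set
    Generators x = Σ FinSet λ D → H D × x ∈ f D

    witness : ∀ {x} → ⟨ Generators ⟩ x → Σ FinSet λ D → H D × x ∈ f D
    witness gen0      = 0 ∷ [] , unit , 0∈f unit
    witness (gen p)   = p
    witness (add p q) with witness p | witness q
    ... | D , H[D] , x∈fD | E , H[E] , y∈fE =
      D ⊕ E , closed H[D] H[E] , f-⊕⁺ H[D] H[E] x∈fD y∈fE

    ∈f-⊕ˡ : ∀ {D E x} → H D → H E → x ∈ f D → x ∈ f (D ⊕ E)
    ∈f-⊕ˡ {x = x} H[D] H[E] x∈fD = subst (_∈ f _) (+-identityʳ x) (f-⊕⁺ H[D] H[E] x∈fD (0∈f H[E]))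

    ∈f-⊕ʳ : ∀ {D E y} → H D → H E → y ∈ f E → y ∈ f (D ⊕ E)
    ∈f-⊕ʳ H[D] H[E] = f-⊕⁺ H[D] H[E] (0∈f H[D])

    gather : ∀ L → All ⟨ Generators ⟩ L → Σ FinSet λ D → H D × (∀ {x} → x ∈ L → x ∈ f D)
    gather []      []         = 0 ∷ [] , unit , λ ()
    gather (x ∷ L) (x∈ ∷ L⊆) with witness x∈ | gather L L⊆
    ... | D , H[D] , x∈fD | E , H[E] , L⊆fE = D ⊕ E , closed H[D] H[E] , λ where
      (here refl) → ∈f-⊕ˡ H[D] H[E] x∈fD
      (there y∈L) → ∈f-⊕ʳ H[D] H[E] (L⊆fE y∈L)

    single-generator : ExcludedMiddle 0ℓ →
      Σ FinSet λ D → H D × (∀ {x} → ⟨ Generators ⟩ x → ⟨ (_∈ f D) ⟩ x)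
    single-generator em with Classical.finite-generators em ⟨ Generators ⟩
    ... | L , L⊆ , ⟨Gen⟩⊆⟨L⟩ with gather L L⊆
    ... | D , H[D] , L⊆fD = D , H[D] , ⟨⟩-map L⊆fD ∘ ⟨Gen⟩⊆⟨L⟩

  id-compatible : Compatible id
  id-compatible = record { 0∈f = has0 ; f-⊕⁺ = λ _ _ → ∈-⊕⁺ }

  rev-compatible : Compatible rev
  rev-compatible = record
    { 0∈f = 0∈rev ∘ has0 ; f-⊕⁺ = λ H[D] H[E] → rev-⊕⁺ (has0 H[D]) (has0 H[E]) }

  module S = Generated id-compatible
  module T = Generated rev-compatible

  generator : ExcludedMiddle 0ℓ →
    Σ FinSet λ A → H A × (S[ H ] ≐ ⟨ (_∈ A) ⟩) × (T[ H ] ≐ ⟨ (_∈ rev A) ⟩)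
  generator em with S.single-generator em | T.single-generator em
  ... | D , H[D] , S⊆⟨D⟩ | E , H[E] , T⊆⟨revE⟩ = D ⊕ E , H[D⊕E] ,
    (λ x → mk⇔ (⟨⟩-map (S.∈f-⊕ˡ H[D] H[E]) ∘ S⊆⟨D⟩) (⟨⟩-map λ p → D ⊕ E , H[D⊕E] , p)) ,
    (λ x → mk⇔ (⟨⟩-map (T.∈f-⊕ʳ H[D] H[E]) ∘ T⊆⟨revE⟩) (⟨⟩-map λ p → D ⊕ E , H[D⊕E] , p))
    where
    H[D⊕E] : H (D ⊕ E)
    H[D⊕E] = closed H[D] H[E]

  Pfin0[S]∩revPfin0[T]⊆⟦⟧ : ∀ {A B} → H A → (S[ H ] ≐ ⟨ (_∈ A) ⟩) → (T[ H ] ≐ ⟨ (_∈ rev A) ⟩) →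
                             Pfin0 S[ H ] B × InRevPfin0 T[ H ] B → ⟦ A ⟧ B
  Pfin0[S]∩revPfin0[T]⊆⟦⟧ H[A] S≐⟨A⟩ T≐⟨revA⟩ =
    Pfin0∩revPfin0⊆⟦⟧ (has0 H[A]) (Equivalence.to (S≐⟨A⟩ _)) (Equivalence.to (T≐⟨revA⟩ _))

  H⇔⟦⟧ : ∀ {A} → H A → (S[ H ] ≐ ⟨ (_∈ A) ⟩) → (T[ H ] ≐ ⟨ (_∈ rev A) ⟩) → ∀ B → H B ⇔ ⟦ A ⟧ B
  H⇔⟦⟧ H[A] S≐⟨A⟩ T≐⟨revA⟩ B =
    mk⇔ (Pfin0[S]∩revPfin0[T]⊆⟦⟧ H[A] S≐⟨A⟩ T≐⟨revA⟩ ∘ H⊆Pfin0[S]∩revPfin0[T]) (⟦⟧⊆H H[A])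

theorem4p3 : ExcludedMiddle 0ℓ →
    (H : FinSet → Set) → DivClosedSubmonoid H →
    ((∀ B → H B ⇔ (Pfin0 S[ H ] B × InRevPfin0 T[ H ] B))
    × Σ FinSet (λ A → H A × (S[ H ] ≐ ⟨ (λ x → x ∈ A) ⟩) × (T[ H ] ≐ ⟨ (λ x → x ∈ rev A) ⟩)))
    × (∀ A → H A → (S[ H ] ≐ ⟨ (λ x → x ∈ A) ⟩) → (T[ H ] ≐ ⟨ (λ x → x ∈ rev A) ⟩)
         → ∀ B → H B ⇔ ⟦ A ⟧ B)
theorem4p3 em H isH with DivisorClosed.generator H isH em
... | A₀ , H[A₀] , S≐⟨A₀⟩ , T≐⟨revA₀⟩ =
  (characterisation , A₀ , H[A₀] , S≐⟨A₀⟩ , T≐⟨revA₀⟩) , λ A H[A] → H⇔⟦⟧ H[A]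
  where
  open DivisorClosed H isH

  characterisation : ∀ B → H B ⇔ (Pfin0 S[ H ] B × InRevPfin0 T[ H ] B)
  characterisation B = mk⇔ H⊆Pfin0[S]∩revPfin0[T]
    (⟦⟧⊆H H[A₀] ∘ Pfin0[S]∩revPfin0[T]⊆⟦⟧ H[A₀] S≐⟨A₀⟩ T≐⟨revA₀⟩)
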